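{- Let $P,Q$ be processes of $\mathrm a\pi$ with $P\equiv\!\Rrightarrow Q$, and let $a\in\{x,\bar x\mid x\in\mathcal N\}$. If $P\downarrow_a$ then $Q\downarrow_a$.
   Context: Fix an infinite set $\mathcal N$ of names. Processes of $\pi$: $P ::= \mathbf{0} \mid \bar x z.P \mid x(y).P \mid P|Q \mid (y)P \mid\ !P$; $\mathrm{fn}(P)$, $\mathrm n(P)$ free/all names; $P\{w/y\}$ capture-avoiding substitution. $\mathrm a\pi$: the sublanguage where every output prefix has the form $\bar xz.\mathbf 0$, written $\bar xz$. Structural congruence $\equiv$: smallest congruence with $P|(Q|R)\equiv(P|Q)|R$, $P|Q\equiv Q|P$, $P|\mathbf 0\equiv P$, $!P\equiv P|!P$, $(y)\mathbf 0\equiv\mathbf 0$, $(y)(u)P\equiv(u)(y)P$, $(w)(P|Q)\equiv P|(w)Q$, $(y)P\equiv(w)P\{w/y\}$, $x(y).P\equiv x(w).P\{w/y\}$ ($w\notin\mathrm n(P)$). $\equiv\!\Rrightarrow$ is the smallest relation on $\mathrm a\pi$ such that: (1) $(v)(\bar vy\,|\,P\,|\,v(z).Q)\equiv\!\Rrightarrow P|(Q\{y/z\})$ whenever $v\notin\mathrm{fn}(P)\cup\mathrm{fn}(Q\{y/z\})$; (2) if $P\equiv\!\Rrightarrow Q$ then $P|C\equiv\!\Rrightarrow Q|C$ for every $C$; (3) if $P\equiv\!\Rrightarrow Q$ then $(w)P\equiv\!\Rrightarrow(w)Q$; (4) if $P\equiv P'\equiv\!\Rrightarrow Q'\equiv Q$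 then $P\equiv\!\Rrightarrow Q$. Strong barbs: $P\downarrow_x$ (resp. $P\downarrow_{\bar x}$) if $P$ has an occurrence of a subterm $x(z).R$ (resp. $\bar xy.R$) not lying strictly within an input/output prefix and not in the scope of a restriction binding $x$. -}

module Defs where

open import Data.Nat using (ℕ; suc; _⊔_)
open import Data.Nat.Properties using (_≟_)
open import Data.List using (List; []; _∷_; _++_; filter; map; foldr)
open import Data.List.Membership.DecPropositional _≟_ public using (_∈_; _∉_; _∈?_)
open import Relation.Nullary using (¬_; ¬?; yes; no)
open import Relation.Binary.PropositionalEquality using (_≡_; _≢_)

Name : Set
Name = ℕ

data Proc : Set where
  𝟎   : Proc
  out : Name → Name → Proc → Proc
  inp : Name → Name → Proc → Proc   -- x(y).P   (y bound in P)
  _∥_ : Proc → Proc → Proc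
  ν   : Name → Proc → Proc          -- (y)P     (y bound in P)
  rep : Proc → Proc

infixl 5 _∥_

remove : Name → List Name → List Name
remove y = filter (λ u → ¬? (u ≟ y))

fn : Proc → List Name
fn 𝟎 = []
fn (out x z P) = x ∷ z ∷ fn P
fn (inp x y P) = x ∷ remove y (fn P)
fn (P ∥ Q) = fn P ++ fn Q
fn (ν y P) = remove y (fn P)
fn (rep P) = fn P

names : Proc → List Name
names 𝟎 = []
names (out x z P) = x ∷ z ∷ names P
names (inp x y P) = x ∷ y ∷ names P
names (P ∥ Q) = names P ++ names Q
names (ν y P) = y ∷ names P
names (rep P) = names P

Ren : Set
Ren = Name → Name

idR : Ren
idR u = u

update : Ren → Name → Name → Ren
update σ y w u with u ≟ y
... | yes _ = w
... | no  _ = σ u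

fresh : List Name → Name
fresh l = suc (foldr _⊔_ 0 l)

-- choice of the new bound name when pushing σ under a binder y with body P:
-- keep y unless it would capture, otherwise take a fresh name.
pick : Ren → Name → Proc → Name
pick σ y P with y ∈? map σ (remove y (fn P))
... | yes _ = fresh (map σ (remove y (fn P)))
... | no  _ = y

sub : Ren → Proc → Proc
sub σ 𝟎 = 𝟎
sub σ (out x z P) = out (σ x) (σ z) (sub σ P)
sub σ (inp x y P) = inp (σ x) (pick σ y P) (sub (update σ y (pick σ y P)) P)
sub σ (P ∥ Q) = sub σ P ∥ sub σ Q
sub σ (ν y P) = ν (pick σ y P) (sub (update σ y (pick σ y P)) P)
sub σ (rep P) = rep (sub σ P)

_[_/_] : Proc → Name → Name → Proc
P [ w / y ] = sub (update idR y w) P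

-- The asynchronous sublanguage aπ: every output prefix is x̄z.0
data Async : Proc → Set where
  𝟎   : Async 𝟎
  out : ∀ {x z} → Async (out x z 𝟎)
  inp : ∀ {x y P} → Async P → Async (inp x y P)
  _∥_ : ∀ {P Q} → Async P → Async Q → Async (P ∥ Q)
  ν   : ∀ {y P} → Async P → Async (ν y P)
  rep : ∀ {P} → Async P → Async (rep P)

infix 4 _≡ₛ_
data _≡ₛ_ : Proc → Proc → Set where
  ≡-refl  : ∀ {P} → P ≡ₛ P
  ≡-sym   : ∀ {P Q} → P ≡ₛ Q → Q ≡ₛ P
  ≡-trans : ∀ {P Q R} → P ≡ₛ Q → Q ≡ₛ R → P ≡ₛ R
  c-out   : ∀ {x z P Q} → P ≡ₛ Q → out x z P ≡ₛ out x z Q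
  c-inp   : ∀ {x y P Q} → P ≡ₛ Q → inp x y P ≡ₛ inp x y Q
  c-par   : ∀ {P P' Q Q'} → P ≡ₛ P' → Q ≡ₛ Q' → P ∥ Q ≡ₛ P' ∥ Q'
  c-res   : ∀ {y P Q} → P ≡ₛ Q → ν y P ≡ₛ ν y Q
  c-rep   : ∀ {P Q} → P ≡ₛ Q → rep P ≡ₛ rep Q
  par-assoc : ∀ {P Q R} → P ∥ (Q ∥ R) ≡ₛ (P ∥ Q) ∥ R
  par-comm  : ∀ {P Q} → P ∥ Q ≡ₛ Q ∥ P
  par-nil   : ∀ {P} → P ∥ 𝟎 ≡ₛ P
  rep-unf   : ∀ {P} → rep P ≡ₛ P ∥ rep P
  res-nil   : ∀ {y} → ν y 𝟎 ≡ₛ 𝟎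
  res-swap  : ∀ {y u P} → ν y (ν u P) ≡ₛ ν u (ν y P)
  extr      : ∀ {w P Q} → w ∉ names P → ν w (P ∥ Q) ≡ₛ P ∥ ν w Q
  α-res     : ∀ {y w P} → w ∉ names P → ν y P ≡ₛ ν w (P [ w / y ])
  α-inp     : ∀ {x y w P} → w ∉ names P → inp x y P ≡ₛ inp x w (P [ w / y ])

infix 4 _≡⇛_
data _≡⇛_ : Proc → Proc → Set where
  com : ∀ {v y z P Q} → Async P → Async Q →
        v ∉ fn P → v ∉ fn (Q [ y / z ]) →
        ν v (out v y 𝟎 ∥ P ∥ inp v z Q) ≡⇛ P ∥ (Q [ y / z ])
  par : ∀ {P Q C} → Async C → P ≡⇛ Q → P ∥ C ≡⇛ Q ∥ C
  res : ∀ {w P Q} → P ≡⇛ Q → ν w P ≡⇛ ν w Q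
  str : ∀ {P P' Q' Q} → Async P → Async Q →
        P ≡ₛ P' → P' ≡⇛ Q' → Q' ≡ₛ Q → P ≡⇛ Q

data Act : Set where
  inA  : Name → Act
  outA : Name → Act

subj : Act → Name
subj (inA x) = x
subj (outA x) = x

infix 4 _↓_
data _↓_ : Proc → Act → Set where
  b-inp : ∀ {x z R} → inp x z R ↓ inA x
  b-out : ∀ {x y R} → out x y R ↓ outA x
  b-parL : ∀ {P Q a} → P ↓ a → P ∥ Q ↓ a
  b-parR : ∀ {P Q a} → Q ↓ a → P ∥ Q ↓ a
  b-res : ∀ {y P a} → subj a ≢ y → P ↓ a → ν y P ↓ a
  b-rep : ∀ {P a} → P ↓ a → rep P ↓ a

{-# OPTIONS --safe #-}
module Submission where

-- Capture-avoiding substitution commutes with barbs up to renaming their subject, so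
-- barbs are invariant under structural congruence: in scope extrusion and α-conversion
-- the freshness side condition keeps the subject of a barb away from the new binder.
-- A communication consumes only the two prefixes on the restricted channel, which the
-- restriction already hides, and whatever else was at top level stays there.

open import Defs
open import Data.Nat using (_≤_; _⊔_)
open import Data.Nat.Properties using (_≟_; m≤m⊔n; m≤n⊔m; ≤-trans; 1+n≰n)
open import Data.List using (_∷_; foldr; map)
open import Data.List.Relation.Unary.Any using (here; there)
open import Data.List.Membership.Propositional.Properties using (∈-map⁺; ∈-++⁺ˡ; ∈-++⁺ʳ; ∈-filter⁺)
open import Data.Product using (_×_; _,_; ∃-syntax)
open import Data.Empty using (⊥-elim)
open import Level using (0ℓ)
open import Function.Bundles using (_⇔_; mk⇔; Equivalence)
open import Function.Properties.Equivalence using (⇔-isEquivalence)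
open import Relation.Binary.Structures using (IsEquivalence)
open import Relation.Nullary using (¬?; yes; no)
open import Relation.Binary.PropositionalEquality using (_≡_; _≢_; refl; sym; trans; cong; subst)

open Equivalence using (to; from)
private module ⇔ = IsEquivalence (⇔-isEquivalence {ℓ = 0ℓ})

private
  variable
    x y z w : Name
    a : Act
    P P′ Q Q′ : Proc

∈⇒≤foldr⊔ : ∀ {l} → x ∈ l → x ≤ foldr _⊔_ 0 l
∈⇒≤foldr⊔ {l = u ∷ _} (here refl) = m≤m⊔n u _
∈⇒≤foldr⊔ {l = u ∷ _} (there x∈l) = ≤-trans (∈⇒≤foldr⊔ x∈l) (m≤n⊔m u _)

fresh-∉ : ∀ l → fresh l ∉ l
fresh-∉ l fresh∈l = 1+n≰n (∈⇒≤foldr⊔ fresh∈l)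

update-≡ : ∀ σ y w → update σ y w y ≡ w
update-≡ σ y w with y ≟ y
... | yes _ = refl
... | no y≢y = ⊥-elim (y≢y refl)

update-≢ : ∀ σ y w u → u ≢ y → update σ y w u ≡ σ u
update-≢ σ y w u u≢y with u ≟ y
... | yes u≡y = ⊥-elim (u≢y u≡y)
... | no _ = refl

pick-∉ : ∀ σ y P → pick σ y P ∉ map σ (remove y (fn P))
pick-∉ σ y P with y ∈? map σ (remove y (fn P))
... | yes _ = fresh-∉ (map σ (remove y (fn P)))
... | no y∉ = y∉

pick-avoids : ∀ σ y P {u} → u ∈ fn P → u ≢ y → σ u ≢ pick σ y P
pick-avoids σ y P u∈P u≢y σu≡pick =
  pick-∉ σ y P (subst (_∈ map σ (remove y (fn P))) σu≡pick
                  (∈-map⁺ σ (∈-filter⁺ (λ v → ¬? (v ≟ y)) u∈P u≢y)))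

renAct : Ren → Act → Act
renAct σ (inA x) = inA (σ x)
renAct σ (outA x) = outA (σ x)

subj-renAct : ∀ σ a → subj (renAct σ a) ≡ σ (subj a)
subj-renAct σ (inA x) = refl
subj-renAct σ (outA x) = refl

renAct-id : ∀ a → renAct idR a ≡ a
renAct-id (inA x) = refl
renAct-id (outA x) = refl

renAct-update : ∀ σ a → subj a ≢ y → renAct (update σ y w) a ≡ renAct σ a
renAct-update σ (inA x) x≢y = cong inA (update-≢ σ _ _ x x≢y)
renAct-update σ (outA x) x≢y = cong outA (update-≢ σ _ _ x x≢y)

renAct-update⁻¹ : ∀ σ {a b} → renAct (update σ y w) a ≡ b → subj b ≢ w →
                  subj a ≢ y × renAct σ a ≡ b
renAct-update⁻¹ {y = y} {w = w} σ {a} refl b≢w = a≢y , sym (renAct-update σ a a≢y)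
  where
  a≢y : subj a ≢ y
  a≢y refl = b≢w (trans (subj-renAct _ a) (update-≡ σ (subj a) w))

↓-subj∈fn : P ↓ a → subj a ∈ fn P
↓-subj∈fn b-inp = here refl
↓-subj∈fn b-out = here refl
↓-subj∈fn (b-parL p) = ∈-++⁺ˡ (↓-subj∈fn p)
↓-subj∈fn {P = P ∥ _} (b-parR p) = ∈-++⁺ʳ (fn P) (↓-subj∈fn p)
↓-subj∈fn {P = ν y _} (b-res a≢y p) = ∈-filter⁺ (λ u → ¬? (u ≟ y)) (↓-subj∈fn p) a≢y
↓-subj∈fn (b-rep p) = ↓-subj∈fn p

↓-subj∈names : P ↓ a → subj a ∈ names P
↓-subj∈names b-inp = here refl
↓-subj∈names b-out = here refl
↓-subj∈names (b-parL p) = ∈-++⁺ˡ (↓-subj∈names p)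
↓-subj∈names {P = P ∥ _} (b-parR p) = ∈-++⁺ʳ (names P) (↓-subj∈names p)
↓-subj∈names (b-res _ p) = there (↓-subj∈names p)
↓-subj∈names (b-rep p) = ↓-subj∈names p

∉names⇒subj≢ : w ∉ names P → P ↓ a → subj a ≢ w
∉names⇒subj≢ {P = P} w∉P p a≡w = w∉P (subst (_∈ names P) a≡w (↓-subj∈names p))

↓-sub : ∀ σ → P ↓ a → sub σ P ↓ renAct σ a
↓-sub σ b-inp = b-inp
↓-sub σ b-out = b-out
↓-sub σ (b-parL p) = b-parL (↓-sub σ p)
↓-sub σ (b-parR p) = b-parR (↓-sub σ p)
↓-sub σ (b-rep p) = b-rep (↓-sub σ p)
↓-sub {P = ν y P} {a} σ (b-res a≢y p) =
  b-res subj≢pick (subst (sub σ′ P ↓_) (renAct-update σ a a≢y) (↓-sub σ′ p))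
  where
  σ′ = update σ y (pick σ y P)
  subj≢pick : subj (renAct σ a) ≢ pick σ y P
  subj≢pick eq = pick-avoids σ y P (↓-subj∈fn p) a≢y (trans (sym (subj-renAct σ a)) eq)

sub-↓ : ∀ σ P {b} → sub σ P ↓ b → ∃[ a ] P ↓ a × renAct σ a ≡ b
sub-↓ σ (inp x y P) b-inp = inA x , b-inp , refl
sub-↓ σ (out x z P) b-out = outA x , b-out , refl
sub-↓ σ (P ∥ Q) (b-parL p) = let a , q , eq = sub-↓ σ P p in a , b-parL q , eq
sub-↓ σ (P ∥ Q) (b-parR p) = let a , q , eq = sub-↓ σ Q p in a , b-parR q , eq
sub-↓ σ (rep P) (b-rep p) = let a , q , eq = sub-↓ σ P p in a , b-rep q , eq
sub-↓ σ (ν y P) (b-res b≢pick p) =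
  let a , q , eq = sub-↓ (update σ y (pick σ y P)) P p
      a≢y , eq′ = renAct-update⁻¹ σ eq b≢pick
  in a , b-res a≢y q , eq′

infix 4 _≈↓_
_≈↓_ : Proc → Proc → Set
P ≈↓ Q = ∀ a → P ↓ a ⇔ Q ↓ a

∥-map↓ : (P ↓ a → P′ ↓ a) → (Q ↓ a → Q′ ↓ a) → P ∥ Q ↓ a → P′ ∥ Q′ ↓ a
∥-map↓ f g (b-parL p) = b-parL (f p)
∥-map↓ f g (b-parR q) = b-parR (g q)

∥-cong-≈↓ : P ≈↓ P′ → Q ≈↓ Q′ → P ∥ Q ≈↓ P′ ∥ Q′
∥-cong-≈↓ P≈P′ Q≈Q′ a =
  mk⇔ (∥-map↓ (to (P≈P′ a)) (to (Q≈Q′ a))) (∥-map↓ (from (P≈P′ a)) (from (Q≈Q′ a)))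

ν-cong-≈↓ : P ≈↓ Q → ν y P ≈↓ ν y Q
ν-cong-≈↓ P≈Q a = mk⇔ (λ { (b-res a≢y p) → b-res a≢y (to (P≈Q a) p) })
                      (λ { (b-res a≢y q) → b-res a≢y (from (P≈Q a) q) })

rep-cong-≈↓ : P ≈↓ Q → rep P ≈↓ rep Q
rep-cong-≈↓ P≈Q a = mk⇔ (λ { (b-rep p) → b-rep (to (P≈Q a) p) })
                        (λ { (b-rep q) → b-rep (from (P≈Q a) q) })

out-≈↓ : out x z P ≈↓ out x z Q
out-≈↓ a = mk⇔ (λ { b-out → b-out }) (λ { b-out → b-out })

inp-≈↓ : inp x y P ≈↓ inp x z Q
inp-≈↓ a = mk⇔ (λ { b-inp → b-inp }) (λ { b-inp → b-inp })

∥-assoc-≈↓ : ∀ {R} → P ∥ (Q ∥ R) ≈↓ (P ∥ Q) ∥ R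
∥-assoc-≈↓ a = mk⇔ (λ { (b-parL p) → b-parL (b-parL p)
                       ; (b-parR (b-parL q)) → b-parL (b-parR q)
                       ; (b-parR (b-parR r)) → b-parR r })
                   (λ { (b-parL (b-parL p)) → b-parL p
                       ; (b-parL (b-parR q)) → b-parR (b-parL q)
                       ; (b-parR r) → b-parR (b-parR r) })

∥-swap↓ : P ∥ Q ↓ a → Q ∥ P ↓ a
∥-swap↓ (b-parL p) = b-parR p
∥-swap↓ (b-parR q) = b-parL q

ν-swap↓ : ν y (ν z P) ↓ a → ν z (ν y P) ↓ a
ν-swap↓ (b-res a≢y (b-res a≢z p)) = b-res a≢z (b-res a≢y p)

extr-≈↓ : w ∉ names P → ν w (P ∥ Q) ≈↓ P ∥ ν w Q
extr-≈↓ w∉P a = mk⇔ (λ { (b-res _ (b-parL p)) → b-parL p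
                        ; (b-res a≢w (b-parR q)) → b-parR (b-res a≢w q) })
                    (λ { (b-parL p) → b-res (∉names⇒subj≢ w∉P p) (b-parL p)
                        ; (b-parR (b-res a≢w q)) → b-res a≢w (b-parR q) })

α-res-≈↓ : w ∉ names P → ν y P ≈↓ ν w (P [ w / y ])
α-res-≈↓ {w = w} {P = P} {y = y} w∉P a = mk⇔ renamed unrenamed
  where
  σ = update idR y w
  renamed : ν y P ↓ a → ν w (P [ w / y ]) ↓ a
  renamed (b-res a≢y p) =
    b-res (∉names⇒subj≢ w∉P p)
          (subst (sub σ P ↓_) (trans (renAct-update idR a a≢y) (renAct-id a)) (↓-sub σ p))
  unrenamed : ν w (P [ w / y ]) ↓ a → ν y P ↓ a
  unrenamed (b-res a≢w p) =
    let b , q , eq = sub-↓ σ P p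
        b≢y , eq′ = renAct-update⁻¹ idR eq a≢w
    in subst (ν y P ↓_) (trans (sym (renAct-id b)) eq′) (b-res b≢y q)

≡ₛ⇒≈↓ : P ≡ₛ Q → P ≈↓ Q
≡ₛ⇒≈↓ ≡-refl = λ _ → ⇔.refl
≡ₛ⇒≈↓ (≡-sym P≡Q) a = ⇔.sym (≡ₛ⇒≈↓ P≡Q a)
≡ₛ⇒≈↓ (≡-trans P≡Q Q≡R) a = ⇔.trans (≡ₛ⇒≈↓ P≡Q a) (≡ₛ⇒≈↓ Q≡R a)
≡ₛ⇒≈↓ (c-out _) = out-≈↓
≡ₛ⇒≈↓ (c-inp _) = inp-≈↓
≡ₛ⇒≈↓ (c-par P≡P′ Q≡Q′) = ∥-cong-≈↓ (≡ₛ⇒≈↓ P≡P′) (≡ₛ⇒≈↓ Q≡Q′)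
≡ₛ⇒≈↓ (c-res P≡Q) = ν-cong-≈↓ (≡ₛ⇒≈↓ P≡Q)
≡ₛ⇒≈↓ (c-rep P≡Q) = rep-cong-≈↓ (≡ₛ⇒≈↓ P≡Q)
≡ₛ⇒≈↓ par-assoc = ∥-assoc-≈↓
≡ₛ⇒≈↓ par-comm a = mk⇔ ∥-swap↓ ∥-swap↓
≡ₛ⇒≈↓ par-nil a = mk⇔ (λ { (b-parL p) → p ; (b-parR ()) }) b-parL
≡ₛ⇒≈↓ rep-unf a = mk⇔ (λ { (b-rep p) → b-parL p }) (λ { (b-parL p) → b-rep p ; (b-parR p) → p })
≡ₛ⇒≈↓ res-nil a = mk⇔ (λ { (b-res _ ()) }) (λ ())
≡ₛ⇒≈↓ res-swap a = mk⇔ ν-swap↓ ν-swap↓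
≡ₛ⇒≈↓ (extr w∉P) = extr-≈↓ w∉P
≡ₛ⇒≈↓ (α-res w∉P) = α-res-≈↓ w∉P
≡ₛ⇒≈↓ (α-inp _) = inp-≈↓

≡⇛-preserves-↓ : P ≡⇛ Q → P ↓ a → Q ↓ a
≡⇛-preserves-↓ (com _ _ _ _) (b-res v≢v (b-parL (b-parL b-out))) = ⊥-elim (v≢v refl)
≡⇛-preserves-↓ (com _ _ _ _) (b-res _ (b-parL (b-parR p))) = b-parL p
≡⇛-preserves-↓ (com _ _ _ _) (b-res v≢v (b-parR b-inp)) = ⊥-elim (v≢v refl)
≡⇛-preserves-↓ (par _ P⇛Q) (b-parL p) = b-parL (≡⇛-preserves-↓ P⇛Q p)
≡⇛-preserves-↓ (par _ _) (b-parR c) = b-parR c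
≡⇛-preserves-↓ (res P⇛Q) (b-res a≢w p) = b-res a≢w (≡⇛-preserves-↓ P⇛Q p)
≡⇛-preserves-↓ {a = a} (str _ _ P≡P′ P′⇛Q′ Q′≡Q) p =
  to (≡ₛ⇒≈↓ Q′≡Q a) (≡⇛-preserves-↓ P′⇛Q′ (to (≡ₛ⇒≈↓ P≡P′ a) p))

lemma5 : ∀ {P Q : Proc} → Async P → Async Q → P ≡⇛ Q → (a : Act) → P ↓ a → Q ↓ a
lemma5 _ _ P⇛Q _ = ≡⇛-preserves-↓ P⇛Q
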